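{- For every plane $\pi$ in $\mathrm{PG}(5,q)$, $q\geq 4$ even, we have $r_{2,n}(\pi)=h_1(\pi)$, i.e., the number of hyperplanes in $\mathcal{H}_1$ containing $\pi$ is equal to $\lvert \pi \cap \pi_{\mathcal{N}} \rvert$.
   Context: Points of $\mathrm{PG}(5,q)$ are identified with symmetric $3\times3$ matrices over $\mathbb{F}_q$ up to scalars. For $q$ even, $\pi_{\mathcal{N}}=\mathcal{Z}(Y_0,Y_3,Y_5)$ is the nucleus plane (zero-diagonal matrices, all of rank 2), and $r_{2,n}(\pi)$ is the number of rank-2 points of $\pi$ lying in $\pi_{\mathcal{N}}$. $\mathcal{H}_1$ is the set of hyperplanes $\mathcal{Z}(a_{00}Y_0+a_{01}Y_1+a_{02}Y_2+a_{11}Y_3+a_{12}Y_4+a_{22}Y_5)$ for which the conic $\mathcal{Z}(\sum_{i\le j}a_{ij}X_iX_j)$ of $\mathrm{PG}(2,q)$ is a double line (equivalently, hyperplanes meeting the Veronese surface in a conic), and $h_1(\pi)$ is the number of hyperplanes of $\mathcal{H}_1$ containing $\pi$. -}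

module Defs where

open import Level using (0ℓ)
open import Data.Nat using (ℕ) renaming (_≤_ to _≤ℕ_)
open import Data.Nat.Divisibility using (_∣_)
open import Data.Fin using (Fin)
open import Data.Fin.Properties using (all?)
open import Data.List using (List; []; _∷_; length; filter; concatMap; map)
open import Data.List.Membership.Propositional using (_∈_)
open import Data.List.Relation.Unary.Unique.Propositional using (Unique)
open import Data.List.Relation.Unary.Any using (Any; any?; satisfied)
open import Data.List.Relation.Unary.Any.Properties using ()
open import Data.Vec using (Vec; []; _∷_; zipWith)
open import Data.Vec.Properties using () renaming (≡-dec to vec-≡-dec)
open import Data.Product using (Σ; ∃; _×_; _,_; proj₁; proj₂)
open import Data.Sum using (_⊎_; inj₁; inj₂)
open import Data.Empty using (⊥)
open import Relation.Nullary using (¬_; Dec; yes; no)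
open import Relation.Nullary.Decidable using (_×-dec_; _⊎-dec_; ¬?)
open import Relation.Binary.PropositionalEquality using (_≡_; _≢_; refl; subst)
open import Algebra.Structures using (IsCommutativeRing)

record FiniteField : Set₁ where
  infixl 7 _*_
  infixl 6 _+_
  field
    Carrier  : Set
    _+_ _*_  : Carrier → Carrier → Carrier
    -_       : Carrier → Carrier
    0# 1#    : Carrier
    isCommutativeRing : IsCommutativeRing _≡_ _+_ _*_ -_ 0# 1#
    0≢1      : 0# ≢ 1#
    inverse  : ∀ x → x ≢ 0# → Σ Carrier λ y → x * y ≡ 1#
    _≟_      : (x y : Carrier) → Dec (x ≡ y)
    elements : List Carrier
    complete : ∀ x → x ∈ elements
    unique   : Unique elements

  order : ℕ
  order = length elements

module Geometry (F : FiniteField) where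
  open FiniteField F

  ∃? : {P : Carrier → Set} → ((x : Carrier) → Dec (P x)) → Dec (∃ P)
  ∃? {P} P? with any? P? elements
  ... | yes a = yes (satisfied a)
  ... | no ¬a = no λ { (x , px) → ¬a (subst-any x px) }
    where
    subst-any : ∀ x → P x → Any P elements
    subst-any x px = go (complete x)
      where
      go : ∀ {xs} → x ∈ xs → Any P xs
      go (Any.here refl) = Any.here px
      go (Any.there m)   = Any.there (go m)

  -- vectors of F^6; coordinates (Y0,...,Y5) = (m00,m01,m02,m11,m12,m22)
  V6 : Set
  V6 = Vec Carrier 6

  _≟V_ : (u v : V6) → Dec (u ≡ v)
  _≟V_ = vec-≡-dec _≟_

  zeroV : V6
  zeroV = 0# ∷ 0# ∷ 0# ∷ 0# ∷ 0# ∷ 0# ∷ []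

  _⊕_ : V6 → V6 → V6
  _⊕_ = zipWith _+_

  _·_ : Carrier → V6 → V6
  a · v = Data.Vec.map (a *_) v

  dot : V6 → V6 → Carrier
  dot (a0 ∷ a1 ∷ a2 ∷ a3 ∷ a4 ∷ a5 ∷ []) (y0 ∷ y1 ∷ y2 ∷ y3 ∷ y4 ∷ y5 ∷ []) =
    a0 * y0 + a1 * y1 + a2 * y2 + a3 * y3 + a4 * y4 + a5 * y5

  allVecs : (n : ℕ) → List (Vec Carrier n)
  allVecs ℕ.zero    = [] ∷ []
  allVecs (ℕ.suc n) = concatMap (λ x → map (x ∷_) (allVecs n)) elements

  -- canonical representative of a projective point: first nonzero entry is 1
  Normalized : ∀ {n} → Vec Carrier n → Set
  Normalized []       = ⊥
  Normalized (x ∷ xs) = (x ≡ 1#) ⊎ ((x ≡ 0#) × Normalized xs)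

  normalized? : ∀ {n} (v : Vec Carrier n) → Dec (Normalized v)
  normalized? []       = no λ ()
  normalized? (x ∷ xs) = (x ≟ 1#) ⊎-dec ((x ≟ 0#) ×-dec normalized? xs)

  points : List V6
  points = filter normalized? (allVecs 6)

  countPoints : {P : V6 → Set} → ((v : V6) → Dec (P v)) → ℕ
  countPoints P? = length (filter P? points)

  -- a plane of PG(5,q): the span of three linearly independent vectors
  LinIndep : V6 → V6 → V6 → Set
  LinIndep u v w = ∀ a b c → ((a · u) ⊕ (b · v)) ⊕ (c · w) ≡ zeroV →
                   (a ≡ 0#) × (b ≡ 0#) × (c ≡ 0#)

  InPlane : V6 → V6 → V6 → V6 → Set
  InPlane u v w p = ∃ λ a → ∃ λ b → ∃ λ c → p ≡ ((a · u) ⊕ (b · v)) ⊕ (c · w)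

  inPlane? : ∀ u v w p → Dec (InPlane u v w p)
  inPlane? u v w p = ∃? λ a → ∃? λ b → ∃? λ c → p ≟V (((a · u) ⊕ (b · v)) ⊕ (c · w))

  entry : V6 → Fin 3 → Fin 3 → Carrier
  entry (y0 ∷ y1 ∷ y2 ∷ y3 ∷ y4 ∷ y5 ∷ []) = m
    where
    m : Fin 3 → Fin 3 → Carrier
    m Fin.zero Fin.zero = y0
    m Fin.zero (Fin.suc Fin.zero) = y1
    m Fin.zero (Fin.suc (Fin.suc Fin.zero)) = y2
    m (Fin.suc Fin.zero) Fin.zero = y1
    m (Fin.suc Fin.zero) (Fin.suc Fin.zero) = y3
    m (Fin.suc Fin.zero) (Fin.suc (Fin.suc Fin.zero)) = y4
    m (Fin.suc (Fin.suc Fin.zero)) Fin.zero = y2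
    m (Fin.suc (Fin.suc Fin.zero)) (Fin.suc Fin.zero) = y4
    m (Fin.suc (Fin.suc Fin.zero)) (Fin.suc (Fin.suc Fin.zero)) = y5

  minor : V6 → Fin 3 → Fin 3 → Fin 3 → Fin 3 → Carrier
  minor y i i' j j' = entry y i j * entry y i' j' + - (entry y i j' * entry y i' j)

  det : V6 → Carrier
  det y = entry y 0F 0F * minor y 1F 2F 1F 2F
          + - (entry y 0F 1F * minor y 1F 2F 0F 2F)
          + entry y 0F 2F * minor y 1F 2F 0F 1F
    where
    0F 1F 2F : Fin 3
    0F = Fin.zero
    1F = Fin.suc Fin.zero
    2F = Fin.suc (Fin.suc Fin.zero)

  RankLE1 : V6 → Set
  RankLE1 y = ∀ i i' j j' → minor y i i' j j' ≡ 0#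

  Rank2 : V6 → Set
  Rank2 y = (det y ≡ 0#) × ¬ RankLE1 y

  rank2? : ∀ y → Dec (Rank2 y)
  rank2? y = (det y ≟ 0#) ×-dec ¬? (all? λ i → all? λ i' → all? λ j → all? λ j' →
                                       minor y i i' j j' ≟ 0#)

  InNucleus : V6 → Set
  InNucleus (y0 ∷ y1 ∷ y2 ∷ y3 ∷ y4 ∷ y5 ∷ []) = (y0 ≡ 0#) × (y3 ≡ 0#) × (y5 ≡ 0#)

  inNucleus? : ∀ y → Dec (InNucleus y)
  inNucleus? (y0 ∷ y1 ∷ y2 ∷ y3 ∷ y4 ∷ y5 ∷ []) = (y0 ≟ 0#) ×-dec (y3 ≟ 0#) ×-dec (y5 ≟ 0#)

  r₂ₙ : V6 → V6 → V6 → ℕ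
  r₂ₙ u v w = countPoints (λ p → inPlane? u v w p ×-dec (rank2? p ×-dec inNucleus? p))

  -- Hyperplanes: a point a = (a00,a01,a02,a11,a12,a22) of the dual space gives
  -- Z(a00 Y0 + a01 Y1 + a02 Y2 + a11 Y3 + a12 Y4 + a22 Y5).
  -- The conic Z(Σ_{i≤j} a_ij X_i X_j) is a double line iff
  -- Σ_{i≤j} a_ij X_i X_j = λ (l0 X0 + l1 X1 + l2 X2)^2 as polynomials,
  -- with λ ≠ 0 and (l0,l1,l2) ≠ 0; compared coefficientwise.
  two : Carrier
  two = 1# + 1#

  DoubleLineEq : V6 → Carrier → Carrier → Carrier → Carrier → Set
  DoubleLineEq (a00 ∷ a01 ∷ a02 ∷ a11 ∷ a12 ∷ a22 ∷ []) λ' l0 l1 l2 =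
    (a00 ≡ λ' * (l0 * l0)) × (a01 ≡ two * λ' * (l0 * l1)) × (a02 ≡ two * λ' * (l0 * l2)) ×
    (a11 ≡ λ' * (l1 * l1)) × (a12 ≡ two * λ' * (l1 * l2)) × (a22 ≡ λ' * (l2 * l2))

  doubleLineEq? : ∀ a λ' l0 l1 l2 → Dec (DoubleLineEq a λ' l0 l1 l2)
  doubleLineEq? (a00 ∷ a01 ∷ a02 ∷ a11 ∷ a12 ∷ a22 ∷ []) λ' l0 l1 l2 =
    (a00 ≟ (λ' * (l0 * l0))) ×-dec (a01 ≟ (two * λ' * (l0 * l1))) ×-dec (a02 ≟ (two * λ' * (l0 * l2))) ×-dec
    (a11 ≟ (λ' * (l1 * l1))) ×-dec (a12 ≟ (two * λ' * (l1 * l2))) ×-dec (a22 ≟ (λ' * (l2 * l2)))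

  IsDoubleLine : V6 → Set
  IsDoubleLine a = ∃ λ λ' → ∃ λ l0 → ∃ λ l1 → ∃ λ l2 →
    ¬ (λ' ≡ 0#) × ¬ ((l0 ≡ 0#) × (l1 ≡ 0#) × (l2 ≡ 0#)) × DoubleLineEq a λ' l0 l1 l2

  isDoubleLine? : ∀ a → Dec (IsDoubleLine a)
  isDoubleLine? a = ∃? λ λ' → ∃? λ l0 → ∃? λ l1 → ∃? λ l2 →
    ¬? (λ' ≟ 0#) ×-dec ¬? ((l0 ≟ 0#) ×-dec (l1 ≟ 0#) ×-dec (l2 ≟ 0#)) ×-dec doubleLineEq? a λ' l0 l1 l2

  ContainsPlane : V6 → V6 → V6 → V6 → Set
  ContainsPlane u v w a = (dot a u ≡ 0#) × (dot a v ≡ 0#) × (dot a w ≡ 0#)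

  containsPlane? : ∀ u v w a → Dec (ContainsPlane u v w a)
  containsPlane? u v w a = (dot a u ≟ 0#) ×-dec (dot a v ≟ 0#) ×-dec (dot a w ≟ 0#)

  -- h_1(π): number of hyperplanes of H_1 containing π
  -- (hyperplanes are listed once each, via normalized coordinate vectors)
  h₁ : V6 → V6 → V6 → ℕ
  h₁ u v w = countPoints (λ a → isDoubleLine? a ×-dec containsPlane? u v w a)

-- Since 2 ∣ q the field has characteristic 2: otherwise x ↦ -x would fix only 0 and pair off
-- the remaining elements, making q odd. In characteristic 2 every element is a square and a
-- symmetric matrix with zero diagonal has determinant 2·y₁y₂y₄ = 0, so r₂,ₙ(π) just counts the
-- points of π ∩ π_N, and the hyperplanes of H₁ are exactly those with a₀₁ = a₀₂ = a₁₂ = 0, whose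
-- conic is Z(a₀₀X₀² + a₁₁X₁² + a₂₂X₂²).
-- Write π = ⟨u, v, w⟩ and let M be the 3 × 3 matrix whose columns are the diagonals (Y₀, Y₃, Y₅)
-- of u, v, w. Then x ↦ x₀u + x₁v + x₂w maps ker M bijectively onto the vectors of π ∩ π_N, and
-- (a₀₀, a₁₁, a₂₂) ↦ a₀₀Y₀ + a₁₁Y₃ + a₂₂Y₅ maps ker Mᵀ bijectively onto the coordinate
-- vectors of the diagonal hyperplanes through π. A square matrix and its transpose have kernels of the same
-- size, and a scaling-closed set of vectors containing 0 has 1 + (q − 1)·N elements, N being its
-- number of projective points; hence both counts agree.

module Submission where

open import Defs
open import Data.Nat using (_≤_)
open import Data.Nat.Divisibility using (_∣_)
open import Relation.Binary.PropositionalEquality using (_≡_)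

open import Level using (Level; 0ℓ)
open import Algebra.Bundles using (CommutativeRing; RawRing)
open import Algebra.Solver.Ring.AlmostCommutativeRing
  using (fromCommutativeRing; _-Raw-AlmostCommutative⟶_)
open import Algebra.Structures using (IsCommutativeRing)
open import Data.Bool using (Bool; true; false)
open import Data.Bool.Properties using (xor-∧-commutativeRing)
open import Data.Empty using (⊥; ⊥-elim)
open import Data.Fin using (toℕ)
open import Data.Fin.Patterns using (0F; 1F; 2F)
open import Data.Fin.Properties using (toℕ-injective)
open import Data.List
  using (List; []; _∷_; [_]; _++_; length; filter; map; concatMap; lookup; cartesianProductWith)
open import Data.List.Properties
  using (length-++; length-map; filter-++; filter-all; filter-none; filter-some; filter-≐; map-cong)
open import Data.List.Membership.Propositional using (_∈_)
open import Data.List.Membership.Propositional.Properties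
  using (∈-filter⁺; ∈-filter⁻; ∈-map⁺; ∈-map⁻; ∈-cartesianProductWith⁺)
open import Data.List.Membership.Propositional.Properties.WithK using (unique∧set⇒bag)
open import Data.List.Relation.Binary.BagAndSetEquality using (∼bag⇒↭)
open import Data.List.Relation.Binary.Permutation.Propositional.Properties using (↭-length)
open import Data.List.Relation.Unary.All as All using (All; []; universal-U)
open import Data.List.Relation.Unary.AllPairs using ([]; _∷_)
open import Data.List.Relation.Unary.Any as Any using (here)
open import Data.List.Relation.Unary.Any.Properties using (lookup-index)
open import Data.List.Relation.Unary.Unique.Propositional using (Unique)
import Data.List.Relation.Unary.Unique.Propositional.Properties as Unique
open import Data.Maybe using (Maybe; just; nothing)
open import Data.Nat as ℕ using (ℕ; zero; suc; pred; _^_)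
open import Data.Nat.Divisibility using (∣m+n∣m⇒∣n; ∣1⇒≡1; m∣m*n)
open import Data.Nat.ListAction using (sum)
import Data.Nat.Properties as ℕₚ
open import Data.Nat.Tactic.RingSolver using (solve-∀)
open import Data.Product using (∃; _×_; _,_; proj₁; proj₂)
open import Data.Sum using (_⊎_; inj₁; inj₂)
open import Data.Unit using (tt)
open import Data.Vec as Vector using (Vec; []; _∷_; head; tail)
open import Data.Vec.Properties
  using (∷-injective; ∷-injectiveʳ; lookup-map; lookup-zipWith; lookup-replicate; tabulate∘lookup; tabulate-cong)
  renaming (≡-dec to ≡-decᵥ)
open import Function using (_∘_; _⇔_; mk⇔)
open import Relation.Binary.Definitions using (DecidableEquality; tri<; tri≈; tri>)
open import Relation.Binary.PropositionalEquality
  using (_≢_; refl; sym; trans; cong; cong₂; subst; module ≡-Reasoning)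
open import Relation.Nullary using (¬_; Dec; yes; no; does; contradiction)
open import Relation.Nullary.Decidable using (_×-dec_)
open import Relation.Unary using (Pred; Decidable; _≐_; _∩_; _∪_; ∁)
open import Relation.Unary.Properties using (_∩?_; _∪?_; ∁?; U?)
module Counting where
  open import Data.Nat using (_+_; _*_)
  open ≡-Reasoning

  private variable
    a b p r : Level
    A : Set a
    B : Set b

  count : {P : Pred A p} → Decidable P → List A → ℕ
  count P? xs = length (filter P? xs)

  count-≐ : {P Q : Pred A p} (P? : Decidable P) (Q? : Decidable Q) → P ≐ Q →
            ∀ xs → count P? xs ≡ count Q? xs
  count-≐ P? Q? P≐Q xs = cong length (filter-≐ P? Q? P≐Q xs)

  count-U : (xs : List A) → count U? xs ≡ length xs
  count-U xs = cong length (filter-all U? (universal-U xs))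

  count-none : {P : Pred A p} (P? : Decidable P) → ∀ {xs} → All (∁ P) xs → count P? xs ≡ 0
  count-none P? ¬Ps = cong length (filter-none P? ¬Ps)

  count-++ : {P : Pred A p} (P? : Decidable P) → ∀ xs ys → count P? (xs ++ ys) ≡ count P? xs + count P? ys
  count-++ P? xs ys = trans (cong length (filter-++ P? xs ys)) (length-++ (filter P? xs))

  count-map : {P : Pred A p} (P? : Decidable P) (f : B → A) →
              ∀ xs → count P? (map f xs) ≡ count (P? ∘ f) xs
  count-map P? f [] = refl
  count-map P? f (x ∷ xs) with does (P? (f x))
  ... | true  = cong suc (count-map P? f xs)
  ... | false = count-map P? f xs

  count-concatMap : {P : Pred A p} (P? : Decidable P) (f : B → List A) →
                    ∀ xs → count P? (concatMap f xs) ≡ sum (map (count P? ∘ f) xs)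
  count-concatMap P? f [] = refl
  count-concatMap P? f (x ∷ xs) =
    trans (count-++ P? (f x) (concatMap f xs)) (cong (count P? (f x) +_) (count-concatMap P? f xs))

  count-filter : {P Q : Pred A p} (P? : Decidable P) (Q? : Decidable Q) →
                 ∀ xs → count Q? (filter P? xs) ≡ count (P? ∩? Q?) xs
  count-filter P? Q? [] = refl
  count-filter P? Q? (x ∷ xs) with does (P? x)
  ... | false = count-filter P? Q? xs
  ... | true with does (Q? x)
  ...   | true  = cong suc (count-filter P? Q? xs)
  ...   | false = count-filter P? Q? xs

  count-∁ : {P : Pred A p} (P? : Decidable P) → ∀ xs → count P? xs + count (∁? P?) xs ≡ length xs
  count-∁ P? [] = refl
  count-∁ P? (x ∷ xs) with does (P? x)
  ... | true  = cong suc (count-∁ P? xs)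
  ... | false = trans (ℕₚ.+-suc _ _) (cong suc (count-∁ P? xs))

  count-partition : {P Q : Pred A p} (P? : Decidable P) (Q? : Decidable Q) →
                    ∀ xs → count P? xs ≡ count (P? ∩? Q?) xs + count (P? ∩? ∁? Q?) xs
  count-partition P? Q? xs = begin
    count P? xs
      ≡⟨ count-∁ Q? (filter P? xs) ⟨
    count Q? (filter P? xs) + count (∁? Q?) (filter P? xs)
      ≡⟨ cong₂ _+_ (count-filter P? Q? xs) (count-filter P? (∁? Q?) xs) ⟩
    count (P? ∩? Q?) xs + count (P? ∩? ∁? Q?) xs
      ∎

  count-∪ : {P Q : Pred A p} (P? : Decidable P) (Q? : Decidable Q) → (∀ {x} → P x → ¬ Q x) →
            ∀ xs → count (P? ∪? Q?) xs ≡ count P? xs + count Q? xs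
  count-∪ {P = P} {Q = Q} P? Q? disjoint xs = trans (count-partition (P? ∪? Q?) P? xs)
    (cong₂ _+_ (count-≐ _ P? ((λ (_ , p) → p) , (λ p → inj₁ p , p)) xs)
               (count-≐ _ Q? (only-Q , (λ q → inj₂ q , λ p → disjoint p q)) xs))
    where
    only-Q : ∀ {x} → (P x ⊎ Q x) × ¬ P x → Q x
    only-Q (inj₁ p , ¬p) = contradiction p ¬p
    only-Q (inj₂ q , _)  = q

  length-unique : {xs ys : List A} → Unique xs → Unique ys → (∀ {z} → z ∈ xs ⇔ z ∈ ys) →
                  length xs ≡ length ys
  length-unique xs! ys! same = ↭-length (∼bag⇒↭ (unique∧set⇒bag xs! ys! same))

  count-bijection : {P : Pred A p} {Q : Pred B r} (P? : Decidable P) (Q? : Decidable Q)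
    {xs : List A} {ys : List B} (f : A → B) → (∀ {x y} → f x ≡ f y → x ≡ y) →
    Unique xs → Unique ys →
    (∀ {x} → x ∈ xs → P x → f x ∈ ys × Q (f x)) →
    (∀ {y} → y ∈ ys → Q y → ∃ λ x → x ∈ xs × P x × f x ≡ y) →
    count P? xs ≡ count Q? ys
  count-bijection P? Q? {xs} {ys} f f-injective xs! ys! into onto = begin
    length (filter P? xs)          ≡⟨ length-map f (filter P? xs) ⟨
    length (map f (filter P? xs))  ≡⟨ length-unique (Unique.map⁺ f-injective (Unique.filter⁺ P? xs!))
                                                    (Unique.filter⁺ Q? ys!) (mk⇔ to from) ⟩
    length (filter Q? ys)          ∎
    where
    to : ∀ {z} → z ∈ map f (filter P? xs) → z ∈ filter Q? ys
    to z∈ with x , x∈ , refl ← ∈-map⁻ f z∈ =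
      let x∈xs , Px = ∈-filter⁻ P? x∈ ; fx∈ys , Qfx = into x∈xs Px in ∈-filter⁺ Q? fx∈ys Qfx
    from : ∀ {z} → z ∈ filter Q? ys → z ∈ map f (filter P? xs)
    from z∈ with z∈ys , Qz ← ∈-filter⁻ Q? z∈ with x , x∈xs , Px , refl ← onto z∈ys Qz =
      ∈-map⁺ f (∈-filter⁺ P? x∈xs Px)

  sum-map-+ : (f g : A → ℕ) → ∀ xs → sum (map (λ x → f x + g x) xs) ≡ sum (map f xs) + sum (map g xs)
  sum-map-+ f g [] = refl
  sum-map-+ f g (x ∷ xs) rewrite sum-map-+ f g xs = interchange (f x) (g x) _ _
    where
    interchange : ∀ a b c d → a + b + (c + d) ≡ a + c + (b + d)
    interchange = solve-∀

  sum-map-const : (m : ℕ) → ∀ (xs : List A) → sum (map (λ _ → m) xs) ≡ length xs * m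
  sum-map-const m []       = refl
  sum-map-const m (_ ∷ xs) = cong (m +_) (sum-map-const m xs)

  sum-two-valued : {P : Pred A p} (P? : Decidable P) {f : A → ℕ} {m n : ℕ} →
    (∀ {x} → P x → f x ≡ m) → (∀ {x} → ¬ P x → f x ≡ n) →
    ∀ xs → sum (map f xs) ≡ count P? xs * m + count (∁? P?) xs * n
  sum-two-valued P? f-P f-∁P [] = refl
  sum-two-valued P? {f} {m} {n} f-P f-∁P (x ∷ xs) with P? x
  ... | yes Px = begin
    f x + sum (map f xs)    ≡⟨ cong₂ _+_ (f-P Px) (sum-two-valued P? f-P f-∁P xs) ⟩
    m + (c * m + c' * n)    ≡⟨ ℕₚ.+-assoc m _ _ ⟨
    suc c * m + c' * n      ∎
    where
    c c' : ℕ
    c  = count P? xs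
    c' = count (∁? P?) xs
  ... | no ¬Px = begin
    f x + sum (map f xs)    ≡⟨ cong₂ _+_ (f-∁P ¬Px) (sum-two-valued P? f-P f-∁P xs) ⟩
    n + (c * m + c' * n)    ≡⟨ ℕₚ.+-comm n _ ⟩
    c * m + c' * n + n      ≡⟨ ℕₚ.+-assoc (c * m) _ _ ⟩
    c * m + (c' * n + n)    ≡⟨ cong (c * m +_) (ℕₚ.+-comm (c' * n) n) ⟩
    c * m + suc c' * n      ∎
    where
    c c' : ℕ
    c  = count P? xs
    c' = count (∁? P?) xs

  sum-count-swap : {R : A → B → Set r} (R? : ∀ x y → Dec (R x y)) → ∀ xs ys →
    sum (map (λ x → count (R? x) ys) xs) ≡ sum (map (λ y → count (λ x → R? x y) xs) ys)
  sum-count-swap R? [] ys = sym (no-terms ys)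
    where
    no-terms : ∀ ys → sum (map (λ y → count (λ x → R? x y) []) ys) ≡ 0
    no-terms []       = refl
    no-terms (_ ∷ ys) = no-terms ys
  sum-count-swap {A = A} {B = B} R? (x ∷ xs) ys = begin
    count (R? x) ys + sum (map (λ x → count (R? x) ys) xs)
      ≡⟨ cong₂ _+_ (row ys) (sum-count-swap R? xs ys) ⟩
    sum (map (column [ x ]) ys) + sum (map (column xs) ys)
      ≡⟨ sum-map-+ (column [ x ]) (column xs) ys ⟨
    sum (map (λ y → column [ x ] y + column xs y) ys)
      ≡⟨ cong sum (map-cong (λ y → count-++ (λ x' → R? x' y) [ x ] xs) ys) ⟨
    sum (map (column (x ∷ xs)) ys)
      ∎
    where
    column : List A → B → ℕ
    column xs y = count (λ x' → R? x' y) xs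
    row : ∀ ys → count (R? x) ys ≡ sum (map (column [ x ]) ys)
    row [] = refl
    row (y ∷ ys) with does (R? x y)
    ... | true  = cong suc (row ys)
    ... | false = row ys

  unbalanced-split : ∀ {k b d X Y} → X ≢ Y → b ≡ suc k + d → b * Y ≡ suc k * X + d * Y → ⊥
  unbalanced-split {k} {b} {d} {X} {Y} X≢Y refl w = X≢Y (sym (ℕₚ.*-cancelˡ-≡ Y X (suc k)
    (ℕₚ.+-cancelʳ-≡ (d * Y) (suc k * Y) (suc k * X) (trans (sym (ℕₚ.*-distribʳ-+ Y (suc k) d)) w))))

  cancel-weighted-split : ∀ {a b c d X Y} → X ≢ Y →
    a + b ≡ c + d → a * X + b * Y ≡ c * X + d * Y → a ≡ c
  cancel-weighted-split {zero}  {c = zero}  _ _ _ = refl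
  cancel-weighted-split {zero}  {c = suc c} X≢Y s w = ⊥-elim (unbalanced-split {k = c} X≢Y s w)
  cancel-weighted-split {suc a} {c = zero}  X≢Y s w = ⊥-elim (unbalanced-split {k = a} X≢Y (sym s) (sym w))
  cancel-weighted-split {suc a} {b} {suc c} {d} {X} {Y} X≢Y s w =
    cong suc (cancel-weighted-split X≢Y (ℕₚ.suc-injective s) (ℕₚ.+-cancelˡ-≡ X _ _
      (trans (sym (ℕₚ.+-assoc X (a * X) (b * Y))) (trans w (ℕₚ.+-assoc X (c * X) (d * Y))))))

module FiniteFieldProperties (F : FiniteField) where
  open Counting
  open FiniteField F
  open Geometry F using (∃?; two)
  open IsCommutativeRing isCommutativeRing
    using (distribʳ; -‿inverseʳ; *-assoc; *-comm; *-identityˡ; zeroʳ)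
  open ≡-Reasoning

  commutativeRing : CommutativeRing 0ℓ 0ℓ
  commutativeRing = record { isCommutativeRing = isCommutativeRing }

  open CommutativeRing commutativeRing using (ring; +-group)
  open import Algebra.Properties.Ring ring using (-‿distribʳ-*) public
  open import Algebra.Properties.Group +-group using (inverseˡ-unique; ε⁻¹≈ε; ⁻¹-involutive) public

  q : ℕ
  q = order

  count-≟ : ∀ a → count (_≟ a) elements ≡ 1
  count-≟ a = length-unique (Unique.filter⁺ (_≟ a) {xs = elements} unique) ([] ∷ []) (mk⇔ to from)
    where
    to : ∀ {z} → z ∈ filter (_≟ a) elements → z ∈ [ a ]
    to z∈ = here (proj₂ (∈-filter⁻ (_≟ a) {xs = elements} z∈))
    from : ∀ {z} → z ∈ [ a ] → z ∈ filter (_≟ a) elements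
    from (here refl) = ∈-filter⁺ (_≟ a) (complete a) refl

  count-≢ : ∀ a → count (∁? (_≟ a)) elements ≡ pred q
  count-≢ a = cong pred (begin
    1 ℕ.+ count (∁? (_≟ a)) elements
      ≡⟨ cong (ℕ._+ count (∁? (_≟ a)) elements) (count-≟ a) ⟨
    count (_≟ a) elements ℕ.+ count (∁? (_≟ a)) elements
      ≡⟨ count-∁ (_≟ a) elements ⟩
    q ∎)

  sum-elements : ∀ a {f : Carrier → ℕ} {m} → (∀ {x} → x ≢ a → f x ≡ m) →
                 sum (map f elements) ≡ f a ℕ.+ pred q ℕ.* m
  sum-elements a {f} {m} f-off-a = begin
    sum (map f elements)
      ≡⟨ sum-two-valued (_≟ a) (λ { refl → refl }) f-off-a elements ⟩
    count (_≟ a) elements ℕ.* f a ℕ.+ count (∁? (_≟ a)) elements ℕ.* m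
      ≡⟨ cong₂ (λ c c' → c ℕ.* f a ℕ.+ c' ℕ.* m) (count-≟ a) (count-≢ a) ⟩
    1 ℕ.* f a ℕ.+ pred q ℕ.* m
      ≡⟨ cong (ℕ._+ pred q ℕ.* m) (ℕₚ.*-identityˡ (f a)) ⟩
    f a ℕ.+ pred q ℕ.* m
      ∎

  sum-supported : ∀ a {f : Carrier → ℕ} → (∀ {x} → x ≢ a → f x ≡ 0) → sum (map f elements) ≡ f a
  sum-supported a {f} f-off-a = begin
    sum (map f elements)    ≡⟨ sum-elements a f-off-a ⟩
    f a ℕ.+ pred q ℕ.* 0    ≡⟨ cong (f a ℕ.+_) (ℕₚ.*-zeroʳ (pred q)) ⟩
    f a ℕ.+ 0               ≡⟨ ℕₚ.+-identityʳ (f a) ⟩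
    f a                     ∎

  injective⇒surjective : (f : Carrier → Carrier) → (∀ {x y} → f x ≡ f y → x ≡ y) →
                         ∀ y → ∃ λ x → f x ≡ y
  injective⇒surjective f f-injective y with ∃? (λ x → f x ≟ y)
  ... | yes y∈image = y∈image
  ... | no  y∉image = ⊥-elim (ℕₚ.<-irrefl (sym nothing-missed)
                        (filter-some (∁? image?) (Any.map (λ { refl → y∉image }) (complete y))))
    where
    image? : Decidable (λ y → ∃ λ x → f x ≡ y)
    image? y = ∃? (λ x → f x ≟ y)
    image-size : count U? elements ≡ count image? elements
    image-size = count-bijection U? image? f f-injective unique unique
      (λ {x} _ _ → complete (f x) , x , refl) (λ _ (x , fx≡y) → x , complete x , tt , fx≡y)
    nothing-missed : count (∁? image?) elements ≡ 0
    nothing-missed = ℕₚ.+-cancelˡ-≡ (count image? elements) _ 0 (begin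
      count image? elements ℕ.+ count (∁? image?) elements  ≡⟨ count-∁ image? elements ⟩
      length elements                                      ≡⟨ trans (sym (count-U elements)) image-size ⟩
      count image? elements                                ≡⟨ ℕₚ.+-identityʳ _ ⟨
      count image? elements ℕ.+ 0                          ∎)

  nonzero-*-cancel : ∀ {x y} → x ≢ 0# → x * y ≡ 0# → y ≡ 0#
  nonzero-*-cancel {x} {y} x≢0 xy≡0 with x⁻¹ , xx⁻¹≡1 ← inverse x x≢0 = begin
    y               ≡⟨ *-identityˡ y ⟨
    1# * y          ≡⟨ cong (_* y) (trans (sym xx⁻¹≡1) (*-comm x x⁻¹)) ⟩
    x⁻¹ * x * y     ≡⟨ *-assoc x⁻¹ x y ⟩
    x⁻¹ * (x * y)   ≡⟨ cong (x⁻¹ *_) xy≡0 ⟩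
    x⁻¹ * 0#        ≡⟨ zeroʳ x⁻¹ ⟩
    0#              ∎

  square≡0⇒≡0 : ∀ {x} → x * x ≡ 0# → x ≡ 0#
  square≡0⇒≡0 {x} xx≡0 with x ≟ 0#
  ... | yes x≡0 = x≡0
  ... | no  x≢0 = nonzero-*-cancel x≢0 xx≡0

  index : Carrier → ℕ
  index x = toℕ (Any.index (complete x))

  index-injective : ∀ {x y} → index x ≡ index y → x ≡ y
  index-injective {x} {y} eq = begin
    x                                         ≡⟨ lookup-index (complete x) ⟩
    lookup elements (Any.index (complete x))  ≡⟨ cong (lookup elements) (toℕ-injective eq) ⟩
    lookup elements (Any.index (complete y))  ≡⟨ lookup-index (complete y) ⟨
    y                                         ∎

  involution-parity : (σ : Carrier → Carrier) → (∀ x → σ (σ x) ≡ x) →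
    q ≡ count (λ x → σ x ≟ x) elements ℕ.+ 2 ℕ.* count (λ x → index x ℕ.<? index (σ x)) elements
  involution-parity σ σσ≡id = begin
    q
      ≡⟨ count-∁ ascent? elements ⟨
    nᴬ ℕ.+ count (∁? ascent?) elements
      ≡⟨ cong (nᴬ ℕ.+_) (count-partition (∁? ascent?) descent? elements) ⟩
    nᴬ ℕ.+ (count (∁? ascent? ∩? descent?) elements ℕ.+ count (∁? ascent? ∩? ∁? descent?) elements)
      ≡⟨ cong (nᴬ ℕ.+_) (cong₂ ℕ._+_ (trans (count-≐ _ descent? only-descent elements)
                                             (sym ascents≡descents))
                                      (count-≐ _ fixed? fixed elements)) ⟩
    nᴬ ℕ.+ (nᴬ ℕ.+ count fixed? elements)
      ≡⟨ rearrange nᴬ _ ⟩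
    count fixed? elements ℕ.+ 2 ℕ.* nᴬ
      ∎
    where
    Ascent Descent Fixed : Pred Carrier 0ℓ
    Ascent  x = index x ℕ.< index (σ x)
    Descent x = index (σ x) ℕ.< index x
    Fixed   x = σ x ≡ x
    ascent? : Decidable Ascent
    ascent? x = index x ℕ.<? index (σ x)
    descent? : Decidable Descent
    descent? x = index (σ x) ℕ.<? index x
    fixed? : Decidable Fixed
    fixed? x = σ x ≟ x
    nᴬ : ℕ
    nᴬ = count ascent? elements
    σ-injective : ∀ {x y} → σ x ≡ σ y → x ≡ y
    σ-injective {x} {y} eq = trans (sym (σσ≡id x)) (trans (cong σ eq) (σσ≡id y))
    ascents≡descents : nᴬ ≡ count descent? elements
    ascents≡descents = count-bijection ascent? descent? σ σ-injective unique unique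
      (λ {x} _ asc → complete (σ x) , subst (ℕ._< index (σ x)) (cong index (sym (σσ≡id x))) asc)
      (λ {y} _ desc → σ y , complete (σ y) , subst (index (σ y) ℕ.<_) (cong index (sym (σσ≡id y))) desc
                    , σσ≡id y)
    only-descent : ∁ Ascent ∩ Descent ≐ Descent
    only-descent = (λ (_ , desc) → desc) , (λ desc → (λ asc → ℕₚ.<-asym asc desc) , desc)
    fixed : ∁ Ascent ∩ ∁ Descent ≐ Fixed
    fixed = (λ (¬asc , ¬desc) → index-injective (sym (equal-index ¬asc ¬desc)))
          , (λ σx≡x → (ℕₚ.<-irrefl (cong index (sym σx≡x))) , (ℕₚ.<-irrefl (cong index σx≡x)))
      where
      equal-index : ∀ {m n} → ¬ m ℕ.< n → ¬ n ℕ.< m → m ≡ n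
      equal-index {m} {n} m≮n n≮m with ℕₚ.<-cmp m n
      ... | tri< m<n _ _ = contradiction m<n m≮n
      ... | tri≈ _ m≡n _ = m≡n
      ... | tri> _ _ n<m = contradiction n<m n≮m
    rearrange : ∀ a b → a ℕ.+ (a ℕ.+ b) ≡ b ℕ.+ 2 ℕ.* a
    rearrange = solve-∀

  even-order⇒two≡0 : 2 ∣ q → two ≡ 0#
  even-order⇒two≡0 2∣q with two ≟ 0#
  ... | yes two≡0 = two≡0
  ... | no  two≢0 = contradiction (∣1⇒≡1 (∣m+n∣m⇒∣n (subst (2 ∣_) q≡2k+1 2∣q) (m∣m*n k))) λ ()
    where
    k : ℕ
    k = count (λ x → index x ℕ.<? index (- x)) elements
    -x≡x⇔x≡0 : (λ x → - x ≡ x) ≐ (_≡ 0#)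
    -x≡x⇔x≡0 = (λ {x} -x≡x → nonzero-*-cancel two≢0 (begin
                    two * x          ≡⟨ distribʳ x 1# 1# ⟩
                    1# * x + 1# * x  ≡⟨ cong₂ _+_ (*-identityˡ x) (*-identityˡ x) ⟩
                    x + x            ≡⟨ cong (x +_) (sym -x≡x) ⟩
                    x + - x          ≡⟨ -‿inverseʳ x ⟩
                    0#               ∎))
             , (λ { refl → ε⁻¹≈ε })
    q≡2k+1 : q ≡ 2 ℕ.* k ℕ.+ 1
    q≡2k+1 = begin
      q
        ≡⟨ involution-parity -_ ⁻¹-involutive ⟩
      count (λ x → (- x) ≟ x) elements ℕ.+ 2 ℕ.* k
        ≡⟨ cong (ℕ._+ 2 ℕ.* k) (trans (count-≐ _ (_≟ 0#) -x≡x⇔x≡0 elements) (count-≟ 0#)) ⟩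
      1 ℕ.+ 2 ℕ.* k
        ≡⟨ ℕₚ.+-comm 1 _ ⟩
      2 ℕ.* k ℕ.+ 1
        ∎

module CoordinateSpace (F : FiniteField) where
  open Counting
  open FiniteField F
  open FiniteFieldProperties F
  open Geometry F using (allVecs; Normalized; normalized?)
  open IsCommutativeRing isCommutativeRing
    using (+-identityˡ; -‿inverseˡ; *-assoc; *-comm; *-identityˡ; *-identityʳ; zeroˡ; zeroʳ)
  open ≡-Reasoning

  private variable
    p : Level
    n : ℕ

  infixr 7 _*ᵥ_
  _*ᵥ_ : Carrier → Vec Carrier n → Vec Carrier n
  c *ᵥ v = Vector.map (c *_) v

  0ᵥ : Vec Carrier n
  0ᵥ = Vector.replicate _ 0#

  _≟ᵥ_ : DecidableEquality (Vec Carrier n)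
  _≟ᵥ_ = ≡-decᵥ _≟_

  ⟨_,_⟩ : Vec Carrier n → Vec Carrier n → Carrier
  ⟨ []     , []     ⟩ = 0#
  ⟨ x ∷ xs , y ∷ ys ⟩ = x * y + ⟨ xs , ys ⟩

  ⟨⟩-comm : (x y : Vec Carrier n) → ⟨ x , y ⟩ ≡ ⟨ y , x ⟩
  ⟨⟩-comm []       []       = refl
  ⟨⟩-comm (x ∷ xs) (y ∷ ys) = cong₂ _+_ (*-comm x y) (⟨⟩-comm xs ys)

  ⟨0ᵥ,⟩ : (y : Vec Carrier n) → ⟨ 0ᵥ , y ⟩ ≡ 0#
  ⟨0ᵥ,⟩ []       = refl
  ⟨0ᵥ,⟩ (y ∷ ys) = trans (cong₂ _+_ (zeroˡ y) (⟨0ᵥ,⟩ ys)) (+-identityˡ 0#)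

  *ᵥ-*ᵥ : ∀ a b (v : Vec Carrier n) → a *ᵥ b *ᵥ v ≡ (a * b) *ᵥ v
  *ᵥ-*ᵥ a b []      = refl
  *ᵥ-*ᵥ a b (x ∷ v) = cong₂ _∷_ (sym (*-assoc a b x)) (*ᵥ-*ᵥ a b v)

  1*ᵥ : (v : Vec Carrier n) → 1# *ᵥ v ≡ v
  1*ᵥ []      = refl
  1*ᵥ (x ∷ v) = cong₂ _∷_ (*-identityˡ x) (1*ᵥ v)

  *ᵥ-inverse : ∀ {a b} → a * b ≡ 1# → (v : Vec Carrier n) → a *ᵥ b *ᵥ v ≡ v
  *ᵥ-inverse ab≡1 v = trans (*ᵥ-*ᵥ _ _ v) (trans (cong (_*ᵥ v) ab≡1) (1*ᵥ v))

  lookup-ext : {v w : Vec Carrier n} → (∀ i → Vector.lookup v i ≡ Vector.lookup w i) → v ≡ w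
  lookup-ext {v = v} {w} same = begin
    v                                  ≡⟨ tabulate∘lookup v ⟨
    Vector.tabulate (Vector.lookup v)  ≡⟨ tabulate-cong same ⟩
    Vector.tabulate (Vector.lookup w)  ≡⟨ tabulate∘lookup w ⟩
    w                                  ∎

  ¬Normalized-0ᵥ : ¬ Normalized (0ᵥ {n})
  ¬Normalized-0ᵥ {suc n} (inj₁ 0≡1)     = 0≢1 0≡1
  ¬Normalized-0ᵥ {suc n} (inj₂ (_ , N)) = ¬Normalized-0ᵥ N

  allVecs-suc : ∀ n → allVecs (suc n) ≡ cartesianProductWith _∷_ elements (allVecs n)
  allVecs-suc n = go elements
    where
    go : ∀ xs → concatMap (λ x → map (x ∷_) (allVecs n)) xs ≡ cartesianProductWith _∷_ xs (allVecs n)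
    go []       = refl
    go (x ∷ xs) = cong (map (x ∷_) (allVecs n) ++_) (go xs)

  allVecs-unique : ∀ n → Unique (allVecs n)
  allVecs-unique zero    = [] ∷ []
  allVecs-unique (suc n) = subst Unique (sym (allVecs-suc n))
    (Unique.cartesianProductWith⁺ _∷_ ∷-injective unique (allVecs-unique n))

  allVecs-complete : (v : Vec Carrier n) → v ∈ allVecs n
  allVecs-complete []      = here refl
  allVecs-complete (x ∷ v) = subst (x ∷ v ∈_) (sym (allVecs-suc _))
    (∈-cartesianProductWith⁺ _∷_ (complete x) (allVecs-complete v))

  length-allVecs : ∀ n → length (allVecs n) ≡ q ^ n
  length-allVecs zero    = refl
  length-allVecs (suc n) = trans (go elements) (cong (q ℕ.*_) (length-allVecs n))
    where
    go : ∀ xs → length (concatMap (λ x → map (x ∷_) (allVecs n)) xs) ≡ length xs ℕ.* length (allVecs n)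
    go []       = refl
    go (x ∷ xs) =
      trans (length-++ (map (x ∷_) (allVecs n))) (cong₂ ℕ._+_ (length-map (x ∷_) (allVecs n)) (go xs))

  count-allVecs-suc : ∀ n {P : Pred (Vec Carrier (suc n)) p} (P? : Decidable P) →
    count P? (allVecs (suc n)) ≡ sum (map (λ x → count (λ v → P? (x ∷ v)) (allVecs n)) elements)
  count-allVecs-suc n P? = trans (count-concatMap P? (λ x → map (x ∷_) (allVecs n)) elements)
    (cong sum (map-cong (λ x → count-map P? (x ∷_) (allVecs n)) elements))

  count-head : ∀ n a {P : Pred (Vec Carrier (suc n)) p} (P? : Decidable P) →
    count (λ v → (head v ≟ a) ×-dec P? v) (allVecs (suc n)) ≡ count (λ v → P? (a ∷ v)) (allVecs n)
  count-head n a P? = begin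
    count (λ v → (head v ≟ a) ×-dec P? v) (allVecs (suc n))
      ≡⟨ count-allVecs-suc n _ ⟩
    sum (map (λ x → count (λ v → (x ≟ a) ×-dec P? (x ∷ v)) (allVecs n)) elements)
      ≡⟨ sum-supported a (λ x≢a → count-none _ (All.universal (λ _ (x≡a , _) → x≢a x≡a) (allVecs n))) ⟩
    count (λ v → (a ≟ a) ×-dec P? (a ∷ v)) (allVecs n)
      ≡⟨ count-≐ _ _ (proj₂ , (λ Pav → refl , Pav)) (allVecs n) ⟩
    count (λ v → P? (a ∷ v)) (allVecs n)
      ∎

  ScaleClosed : Pred (Vec Carrier n) p → Set p
  ScaleClosed P = ∀ {c v} → c ≢ 0# → P v → P (c *ᵥ v)

  count-nonzero-head : ∀ n {P : Pred (Vec Carrier (suc n)) p} (P? : Decidable P) → ScaleClosed P →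
    ∀ {x} → x ≢ 0# → count (λ v → P? (x ∷ v)) (allVecs n) ≡ count (λ v → P? (1# ∷ v)) (allVecs n)
  count-nonzero-head n {P} P? closed {x} x≢0 with x⁻¹ , xx⁻¹≡1 ← inverse x x≢0 =
    count-bijection _ _ (x⁻¹ *ᵥ_) rescale-injective (allVecs-unique n) (allVecs-unique n)
      (λ {v} _ Pxv → allVecs-complete _ , subst (λ c → P (c ∷ x⁻¹ *ᵥ v)) x⁻¹x≡1 (closed x⁻¹≢0 Pxv))
      (λ {w} _ P1w → x *ᵥ w , allVecs-complete _
                   , subst (λ c → P (c ∷ x *ᵥ w)) (*-identityʳ x) (closed x≢0 P1w) , *ᵥ-inverse x⁻¹x≡1 w)
    where
    x⁻¹x≡1 : x⁻¹ * x ≡ 1#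
    x⁻¹x≡1 = trans (*-comm x⁻¹ x) xx⁻¹≡1
    x⁻¹≢0 : x⁻¹ ≢ 0#
    x⁻¹≢0 x⁻¹≡0 = 0≢1 (trans (sym (zeroʳ x)) (trans (cong (x *_) (sym x⁻¹≡0)) xx⁻¹≡1))
    rescale-injective : ∀ {v w : Vec Carrier n} → x⁻¹ *ᵥ v ≡ x⁻¹ *ᵥ w → v ≡ w
    rescale-injective {v} {w} eq =
      trans (sym (*ᵥ-inverse xx⁻¹≡1 v)) (trans (cong (x *ᵥ_) eq) (*ᵥ-inverse xx⁻¹≡1 w))

  count-cone : ∀ n {P : Pred (Vec Carrier n) p} (P? : Decidable P) → P 0ᵥ → ScaleClosed P →
    count P? (allVecs n) ≡ suc (pred q ℕ.* count (normalized? ∩? P?) (allVecs n))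
  count-cone zero P? P0 closed with P? []
  ... | yes _  = cong suc (sym (ℕₚ.*-zeroʳ (pred q)))
  ... | no ¬P0 = contradiction P0 ¬P0
  count-cone {p} (suc n) {P} P? P0 closed = begin
    count P? (allVecs (suc n))
      ≡⟨ count-allVecs-suc n P? ⟩
    sum (map line elements)
      ≡⟨ sum-elements 0# (count-nonzero-head n P? closed) ⟩
    line 0# ℕ.+ pred q ℕ.* line 1#
      ≡⟨ cong (ℕ._+ pred q ℕ.* line 1#) (count-cone n (λ v → P? (0# ∷ v)) P0 closed₀) ⟩
    suc (pred q ℕ.* N₀ ℕ.+ pred q ℕ.* line 1#)
      ≡⟨ cong suc (ℕₚ.*-distribˡ-+ (pred q) N₀ (line 1#)) ⟨
    suc (pred q ℕ.* (N₀ ℕ.+ line 1#))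
      ≡⟨ cong (λ m → suc (pred q ℕ.* m)) (trans (ℕₚ.+-comm N₀ (line 1#)) (sym normalized-count)) ⟩
    suc (pred q ℕ.* count (normalized? ∩? P?) (allVecs (suc n)))
      ∎
    where
    line : Carrier → ℕ
    line x = count (λ v → P? (x ∷ v)) (allVecs n)
    N₀ : ℕ
    N₀ = count (normalized? ∩? (λ v → P? (0# ∷ v))) (allVecs n)
    closed₀ : ScaleClosed (λ v → P (0# ∷ v))
    closed₀ {c} {v} c≢0 P0v = subst (λ x → P (x ∷ c *ᵥ v)) (zeroʳ c) (closed c≢0 P0v)
    Leading1 Leading0 : Pred (Vec Carrier (suc n)) p
    Leading1 v = head v ≡ 1# × P v
    Leading0 v = head v ≡ 0# × Normalized (tail v) × P v
    leading1? : Decidable Leading1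
    leading1? v = (head v ≟ 1#) ×-dec P? v
    leading0? : Decidable Leading0
    leading0? v = (head v ≟ 0#) ×-dec normalized? (tail v) ×-dec P? v
    split : Normalized ∩ P ≐ Leading1 ∪ Leading0
    split = (λ { {_ ∷ _} (inj₁ x≡1 , Pv)        → inj₁ (x≡1 , Pv)
               ; {_ ∷ _} (inj₂ (x≡0 , Nv) , Pv) → inj₂ (x≡0 , Nv , Pv) })
          , (λ { {_ ∷ _} (inj₁ (x≡1 , Pv))      → inj₁ x≡1 , Pv
               ; {_ ∷ _} (inj₂ (x≡0 , Nv , Pv)) → inj₂ (x≡0 , Nv) , Pv })
    normalized-count : count (normalized? ∩? P?) (allVecs (suc n)) ≡ line 1# ℕ.+ N₀
    normalized-count = begin
      count (normalized? ∩? P?) (allVecs (suc n))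
        ≡⟨ count-≐ _ (leading1? ∪? leading0?) split (allVecs (suc n)) ⟩
      count (leading1? ∪? leading0?) (allVecs (suc n))
        ≡⟨ count-∪ leading1? leading0? (λ (x≡1 , _) (x≡0 , _) → 0≢1 (trans (sym x≡0) x≡1))
                   (allVecs (suc n)) ⟩
      count leading1? (allVecs (suc n)) ℕ.+ count leading0? (allVecs (suc n))
        ≡⟨ cong₂ ℕ._+_ (count-head n 1# P?) (count-head n 0# (λ v → normalized? (tail v) ×-dec P? v)) ⟩
      line 1# ℕ.+ N₀
        ∎

  count-orthogonal : ∀ n (z : Vec Carrier (suc n)) → z ≢ 0ᵥ →
    count (λ y → ⟨ z , y ⟩ ≟ 0#) (allVecs (suc n)) ≡ q ^ n
  count-orthogonal n (z₀ ∷ z) z≢0 with z₀ ≟ 0#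
  count-orthogonal zero    (_ ∷ []) z≢0 | yes refl = contradiction refl z≢0
  count-orthogonal (suc n) (_ ∷ z)  z≢0 | yes refl = begin
    count (λ y → ⟨ 0# ∷ z , y ⟩ ≟ 0#) (allVecs (suc (suc n)))
      ≡⟨ count-allVecs-suc (suc n) _ ⟩
    sum (map (λ y₀ → count (λ y → (0# * y₀ + ⟨ z , y ⟩) ≟ 0#) (allVecs (suc n))) elements)
      ≡⟨ cong sum (map-cong (λ y₀ → trans (count-≐ _ _ (drop-head y₀) (allVecs (suc n)))
                                           (count-orthogonal n z (z≢0 ∘ cong (0# ∷_)))) elements) ⟩
    sum (map (λ _ → q ^ n) elements)
      ≡⟨ sum-map-const (q ^ n) elements ⟩
    q ℕ.* q ^ n
      ∎
    where
    drop-head : ∀ y₀ → (λ y → 0# * y₀ + ⟨ z , y ⟩ ≡ 0#) ≐ (λ y → ⟨ z , y ⟩ ≡ 0#)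
    drop-head y₀ = (λ eq → trans (sym (0*y₀+ _)) eq) , (λ eq → trans (0*y₀+ _) eq)
      where
      0*y₀+ : ∀ t → 0# * y₀ + t ≡ t
      0*y₀+ t = trans (cong (_+ t) (zeroˡ y₀)) (+-identityˡ t)
  count-orthogonal n (z₀ ∷ z) z≢0 | no z₀≢0 with z₀⁻¹ , z₀z₀⁻¹≡1 ← inverse z₀ z₀≢0 = begin
    count (λ y → ⟨ z₀ ∷ z , y ⟩ ≟ 0#) (allVecs (suc n))  ≡⟨ solutions-by-tail ⟨
    count U? (allVecs n)                                ≡⟨ count-U (allVecs n) ⟩
    length (allVecs n)                                  ≡⟨ length-allVecs n ⟩
    q ^ n                                               ∎
    where
    solution : Vec Carrier n → Carrier
    solution y = - (z₀⁻¹ * ⟨ z , y ⟩)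
    solution-solves : ∀ y → z₀ * solution y + ⟨ z , y ⟩ ≡ 0#
    solution-solves y = begin
      z₀ * - (z₀⁻¹ * t) + t     ≡⟨ cong (_+ t) (-‿distribʳ-* z₀ (z₀⁻¹ * t)) ⟨
      - (z₀ * (z₀⁻¹ * t)) + t   ≡⟨ cong (λ s → - s + t) (*-assoc z₀ z₀⁻¹ t) ⟨
      - (z₀ * z₀⁻¹ * t) + t     ≡⟨ cong (λ s → - (s * t) + t) z₀z₀⁻¹≡1 ⟩
      - (1# * t) + t            ≡⟨ cong (λ s → - s + t) (*-identityˡ t) ⟩
      - t + t                   ≡⟨ -‿inverseˡ t ⟩
      0#                        ∎
      where
      t : Carrier
      t = ⟨ z , y ⟩
    solution-unique : ∀ {y₀ y} → z₀ * y₀ + ⟨ z , y ⟩ ≡ 0# → solution y ≡ y₀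
    solution-unique {y₀} {y} eq = sym (begin
      y₀                    ≡⟨ *-identityˡ y₀ ⟨
      1# * y₀               ≡⟨ cong (_* y₀) (trans (sym z₀z₀⁻¹≡1) (*-comm z₀ z₀⁻¹)) ⟩
      z₀⁻¹ * z₀ * y₀        ≡⟨ *-assoc z₀⁻¹ z₀ y₀ ⟩
      z₀⁻¹ * (z₀ * y₀)      ≡⟨ cong (z₀⁻¹ *_) (inverseˡ-unique (z₀ * y₀) t eq) ⟩
      z₀⁻¹ * - t            ≡⟨ -‿distribʳ-* z₀⁻¹ t ⟨
      - (z₀⁻¹ * t)          ∎)
      where
      t : Carrier
      t = ⟨ z , y ⟩
    solutions-by-tail : count U? (allVecs n) ≡ count (λ y → ⟨ z₀ ∷ z , y ⟩ ≟ 0#) (allVecs (suc n))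
    solutions-by-tail =
      count-bijection U? _ (λ y → solution y ∷ y) ∷-injectiveʳ (allVecs-unique n) (allVecs-unique (suc n))
        (λ {y} _ _ → allVecs-complete _ , solution-solves y)
        (λ { {y₀ ∷ y} _ eq → y , allVecs-complete y , tt , cong (_∷ y) (solution-unique eq) })

  -- Double counting the pairs (x , y) with ⟨ M x , y ⟩ = 0: each x in the kernel of M
  -- contributes q ^ (n + 1) of them, every other x contributes q ^ n.
  kernel-size-adjoint : 2 ℕ.≤ q → ∀ n (M N : Vec Carrier (suc n) → Vec Carrier (suc n)) →
    (∀ x y → ⟨ M x , y ⟩ ≡ ⟨ x , N y ⟩) →
    count (λ x → M x ≟ᵥ 0ᵥ) (allVecs (suc n)) ≡ count (λ y → N y ≟ᵥ 0ᵥ) (allVecs (suc n))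
  kernel-size-adjoint 2≤q n M N adjoint =
    cancel-weighted-split (ℕₚ.>⇒≢ (ℕₚ.^-monoʳ-< q 2≤q (ℕₚ.n<1+n n)))
      (trans (count-∁ (kernel? M) V) (sym (count-∁ (kernel? N) V)))
      (begin
        weighted M
          ≡⟨ orthogonal-pairs M ⟨
        sum (map (λ x → count (λ y → ⟨ M x , y ⟩ ≟ 0#) V) V)
          ≡⟨ sum-count-swap (λ x y → ⟨ M x , y ⟩ ≟ 0#) V V ⟩
        sum (map (λ y → count (λ x → ⟨ M x , y ⟩ ≟ 0#) V) V)
          ≡⟨ cong sum (map-cong (λ y → count-≐ _ _ (transpose y) V) V) ⟩
        sum (map (λ y → count (λ x → ⟨ N y , x ⟩ ≟ 0#) V) V)
          ≡⟨ orthogonal-pairs N ⟩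
        weighted N
          ∎)
    where
    V : List (Vec Carrier (suc n))
    V = allVecs (suc n)
    kernel? : (L : Vec Carrier (suc n) → Vec Carrier (suc n)) → Decidable (λ x → L x ≡ 0ᵥ)
    kernel? L x = L x ≟ᵥ 0ᵥ
    weighted : (Vec Carrier (suc n) → Vec Carrier (suc n)) → ℕ
    weighted L = count (kernel? L) V ℕ.* q ^ suc n ℕ.+ count (∁? (kernel? L)) V ℕ.* q ^ n
    orthogonal-pairs : ∀ L → sum (map (λ x → count (λ y → ⟨ L x , y ⟩ ≟ 0#) V) V) ≡ weighted L
    orthogonal-pairs L = sum-two-valued (kernel? L) all-orthogonal (count-orthogonal n (L _)) V
      where
      all-orthogonal : ∀ {x} → L x ≡ 0ᵥ → count (λ y → ⟨ L x , y ⟩ ≟ 0#) V ≡ q ^ suc n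
      all-orthogonal {x} Lx≡0 = begin
        count (λ y → ⟨ L x , y ⟩ ≟ 0#) V
          ≡⟨ count-≐ _ U? ((λ _ → tt) , (λ {y} _ → trans (cong ⟨_, y ⟩ Lx≡0) (⟨0ᵥ,⟩ y))) V ⟩
        count U? V    ≡⟨ count-U V ⟩
        length V      ≡⟨ length-allVecs (suc n) ⟩
        q ^ suc n     ∎
    transpose : ∀ y → (λ x → ⟨ M x , y ⟩ ≡ 0#) ≐ (λ x → ⟨ N y , x ⟩ ≡ 0#)
    transpose y = (λ {x} eq → trans (trans (⟨⟩-comm (N y) x) (sym (adjoint x y))) eq)
                , (λ {x} eq → trans (trans (adjoint x y) (⟨⟩-comm x (N y))) eq)

module Characteristic2 (F : FiniteField) (two≡0 : Geometry.two F ≡ FiniteField.0# F) where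
  open Counting
  open FiniteField F
  open FiniteFieldProperties F
  open CoordinateSpace F
  open Geometry F
  open IsCommutativeRing isCommutativeRing using (+-identityˡ; +-identityʳ; *-identityˡ; zeroˡ; zeroʳ)
  open ≡-Reasoning

  -- The ring solver needs coefficients whose equality computes; in characteristic 2 these
  -- can be taken in the prime field 𝔽₂, which also lets it prove identities such as x + x = 0.
  𝔽₂ : RawRing 0ℓ 0ℓ
  𝔽₂ = CommutativeRing.rawRing xor-∧-commutativeRing

  ⟦_⟧₂ : Bool → Carrier
  ⟦ false ⟧₂ = 0#
  ⟦ true  ⟧₂ = 1#

  𝔽₂-embedding : 𝔽₂ -Raw-AlmostCommutative⟶ fromCommutativeRing commutativeRing
  𝔽₂-embedding = record
    { ⟦_⟧ = ⟦_⟧₂ ; +-homo = +-homo ; *-homo = *-homo ; -‿homo = -‿homo ; 0-homo = refl ; 1-homo = refl }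
    where
    +-homo : ∀ a b → ⟦ RawRing._+_ 𝔽₂ a b ⟧₂ ≡ ⟦ a ⟧₂ + ⟦ b ⟧₂
    +-homo false b     = sym (+-identityˡ ⟦ b ⟧₂)
    +-homo true  false = sym (+-identityʳ 1#)
    +-homo true  true  = sym two≡0
    *-homo : ∀ a b → ⟦ RawRing._*_ 𝔽₂ a b ⟧₂ ≡ ⟦ a ⟧₂ * ⟦ b ⟧₂
    *-homo false b = sym (zeroˡ ⟦ b ⟧₂)
    *-homo true  b = sym (*-identityˡ ⟦ b ⟧₂)
    -‿homo : ∀ a → ⟦ RawRing.-_ 𝔽₂ a ⟧₂ ≡ - ⟦ a ⟧₂
    -‿homo false = sym ε⁻¹≈ε
    -‿homo true  = inverseˡ-unique 1# 1# two≡0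

  𝔽₂-equal? : ∀ a b → Maybe (⟦ a ⟧₂ ≡ ⟦ b ⟧₂)
  𝔽₂-equal? false false = just refl
  𝔽₂-equal? true  true  = just refl
  𝔽₂-equal? _     _     = nothing

  open import Algebra.Solver.Ring 𝔽₂ (fromCommutativeRing commutativeRing) 𝔽₂-embedding 𝔽₂-equal?
    using (solve; _:=_; _:+_; _:*_; :-_; con)

  x+x≡0 : ∀ x → x + x ≡ 0#
  x+x≡0 = solve 1 (λ x → x :+ x := con false) refl

  x+y≡0⇒x≡y : ∀ {x y} → x + y ≡ 0# → x ≡ y
  x+y≡0⇒x≡y {x} {y} x+y≡0 = begin
    x            ≡⟨ solve 2 (λ x y → x := x :+ y :+ y) refl x y ⟩
    x + y + y    ≡⟨ cong (_+ y) x+y≡0 ⟩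
    0# + y       ≡⟨ +-identityˡ y ⟩
    y            ∎

  square-injective : ∀ {x y} → x * x ≡ y * y → x ≡ y
  square-injective {x} {y} x²≡y² = x+y≡0⇒x≡y (square≡0⇒≡0 (begin
    (x + y) * (x + y)  ≡⟨ solve 2 (λ x y → (x :+ y) :* (x :+ y) := x :* x :+ y :* y) refl x y ⟩
    x * x + y * y      ≡⟨ cong (_+ y * y) x²≡y² ⟩
    y * y + y * y      ≡⟨ x+x≡0 (y * y) ⟩
    0#                 ∎))

  square-root : ∀ a → ∃ λ r → r * r ≡ a
  square-root = injective⇒surjective (λ x → x * x) square-injective

  two*x*y≡0 : ∀ x y → two * x * y ≡ 0#
  two*x*y≡0 x y = trans (cong (λ t → t * x * y) two≡0) (trans (cong (_* y) (zeroˡ x)) (zeroˡ y))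

  planePoint : V6 → V6 → V6 → Vec Carrier 3 → V6
  planePoint u v w (a ∷ b ∷ c ∷ []) = ((a · u) ⊕ (b · v)) ⊕ (c · w)

  lookup-planePoint : ∀ u v w a b c i →
    Vector.lookup (planePoint u v w (a ∷ b ∷ c ∷ [])) i
      ≡ a * Vector.lookup u i + b * Vector.lookup v i + c * Vector.lookup w i
  lookup-planePoint u v w a b c i =
    trans (lookup-zipWith _+_ i ((a · u) ⊕ (b · v)) (c · w))
          (cong₂ _+_ (trans (lookup-zipWith _+_ i (a · u) (b · v))
                            (cong₂ _+_ (lookup-map i (a *_) u) (lookup-map i (b *_) v)))
                     (lookup-map i (c *_) w))

  planePoint-0ᵥ : ∀ u v w → planePoint u v w 0ᵥ ≡ 0ᵥ
  planePoint-0ᵥ u v w = lookup-ext λ i → begin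
    Vector.lookup (planePoint u v w 0ᵥ) i
      ≡⟨ lookup-planePoint u v w 0# 0# 0# i ⟩
    0# * Vector.lookup u i + 0# * Vector.lookup v i + 0# * Vector.lookup w i
      ≡⟨ solve 3 (λ s t r → con false :* s :+ con false :* t :+ con false :* r := con false) refl _ _ _ ⟩
    0#
      ≡⟨ lookup-replicate i 0# ⟨
    Vector.lookup 0ᵥ i
      ∎

  planePoint-*ᵥ : ∀ u v w c x → c *ᵥ planePoint u v w x ≡ planePoint u v w (c *ᵥ x)
  planePoint-*ᵥ u v w c x@(a ∷ b ∷ d ∷ []) = lookup-ext λ i → begin
    Vector.lookup (c *ᵥ planePoint u v w x) i
      ≡⟨ lookup-map i (c *_) (planePoint u v w x) ⟩
    c * Vector.lookup (planePoint u v w x) i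
      ≡⟨ cong (c *_) (lookup-planePoint u v w a b d i) ⟩
    c * (a * Vector.lookup u i + b * Vector.lookup v i + d * Vector.lookup w i)
      ≡⟨ solve 7 (λ c a b d s t r → c :* (a :* s :+ b :* t :+ d :* r)
                                  := c :* a :* s :+ c :* b :* t :+ c :* d :* r) refl c a b d _ _ _ ⟩
    c * a * Vector.lookup u i + c * b * Vector.lookup v i + c * d * Vector.lookup w i
      ≡⟨ lookup-planePoint u v w (c * a) (c * b) (c * d) i ⟨
    Vector.lookup (planePoint u v w (c *ᵥ x)) i
      ∎

  planePoint-injective : ∀ {u v w} → LinIndep u v w →
                         ∀ {x y} → planePoint u v w x ≡ planePoint u v w y → x ≡ y
  planePoint-injective {u} {v} {w} independent {x@(a ∷ b ∷ c ∷ [])} {y@(a' ∷ b' ∷ c' ∷ [])} same =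
    coordinates-equal (independent (a + a') (b + b') (c + c') (lookup-ext sum≡0))
    where
    coordinates-equal : (a + a' ≡ 0#) × (b + b' ≡ 0#) × (c + c' ≡ 0#) → x ≡ y
    coordinates-equal (a+a'≡0 , b+b'≡0 , c+c'≡0) =
      cong₂ _∷_ (x+y≡0⇒x≡y a+a'≡0) (cong₂ _∷_ (x+y≡0⇒x≡y b+b'≡0) (cong (_∷ []) (x+y≡0⇒x≡y c+c'≡0)))
    sum≡0 : ∀ i → Vector.lookup (planePoint u v w ((a + a') ∷ (b + b') ∷ (c + c') ∷ [])) i
                ≡ Vector.lookup zeroV i
    sum≡0 i = begin
      Vector.lookup (planePoint u v w ((a + a') ∷ (b + b') ∷ (c + c') ∷ [])) i
        ≡⟨ lookup-planePoint u v w _ _ _ i ⟩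
      (a + a') * s + (b + b') * t + (c + c') * r
        ≡⟨ solve 9 (λ a b c a' b' c' s t r → (a :+ a') :* s :+ (b :+ b') :* t :+ (c :+ c') :* r
                                           := (a :* s :+ b :* t :+ c :* r) :+ (a' :* s :+ b' :* t :+ c' :* r))
                   refl a b c a' b' c' s t r ⟩
      (a * s + b * t + c * r) + (a' * s + b' * t + c' * r)
        ≡⟨ cong₂ _+_ (lookup-planePoint u v w a b c i) (lookup-planePoint u v w a' b' c' i) ⟨
      Vector.lookup (planePoint u v w x) i + Vector.lookup (planePoint u v w y) i
        ≡⟨ cong (_+ _) (cong (λ p → Vector.lookup p i) same) ⟩
      Vector.lookup (planePoint u v w y) i + Vector.lookup (planePoint u v w y) i
        ≡⟨ x+x≡0 _ ⟩
      0#
        ≡⟨ lookup-replicate i 0# ⟨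
      Vector.lookup zeroV i
        ∎
      where
      s t r : Carrier
      s = Vector.lookup u i
      t = Vector.lookup v i
      r = Vector.lookup w i

  diagonal : V6 → Vec Carrier 3
  diagonal (y₀ ∷ _ ∷ _ ∷ y₃ ∷ _ ∷ y₅ ∷ []) = y₀ ∷ y₃ ∷ y₅ ∷ []

  diagonalForm : Vec Carrier 3 → V6
  diagonalForm (a₀₀ ∷ a₁₁ ∷ a₂₂ ∷ []) = a₀₀ ∷ 0# ∷ 0# ∷ a₁₁ ∷ 0# ∷ a₂₂ ∷ []

  diagonalForm-injective : ∀ {x y} → diagonalForm x ≡ diagonalForm y → x ≡ y
  diagonalForm-injective {_ ∷ _ ∷ _ ∷ []} {_ ∷ _ ∷ _ ∷ []} eq = cong diagonal eq

  dot-diagonalForm : ∀ y p → dot (diagonalForm y) p ≡ ⟨ diagonal p , y ⟩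
  dot-diagonalForm (a₀₀ ∷ a₁₁ ∷ a₂₂ ∷ []) (y₀ ∷ y₁ ∷ y₂ ∷ y₃ ∷ y₄ ∷ y₅ ∷ []) =
    solve 9 (λ a₀₀ a₁₁ a₂₂ y₀ y₁ y₂ y₃ y₄ y₅ →
               a₀₀ :* y₀ :+ con false :* y₁ :+ con false :* y₂ :+ a₁₁ :* y₃ :+ con false :* y₄ :+ a₂₂ :* y₅
            := y₀ :* a₀₀ :+ (y₃ :* a₁₁ :+ (y₅ :* a₂₂ :+ con false)))
      refl a₀₀ a₁₁ a₂₂ y₀ y₁ y₂ y₃ y₄ y₅

  dot-*ᵥ : ∀ c a p → dot (c *ᵥ a) p ≡ c * dot a p
  dot-*ᵥ c (a₀ ∷ a₁ ∷ a₂ ∷ a₃ ∷ a₄ ∷ a₅ ∷ []) (p₀ ∷ p₁ ∷ p₂ ∷ p₃ ∷ p₄ ∷ p₅ ∷ []) =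
    solve 13 (λ c a₀ a₁ a₂ a₃ a₄ a₅ p₀ p₁ p₂ p₃ p₄ p₅ →
         c :* a₀ :* p₀ :+ c :* a₁ :* p₁ :+ c :* a₂ :* p₂ :+ c :* a₃ :* p₃ :+ c :* a₄ :* p₄ :+ c :* a₅ :* p₅
      := c :* (a₀ :* p₀ :+ a₁ :* p₁ :+ a₂ :* p₂ :+ a₃ :* p₃ :+ a₄ :* p₄ :+ a₅ :* p₅))
      refl c a₀ a₁ a₂ a₃ a₄ a₅ p₀ p₁ p₂ p₃ p₄ p₅

  InNucleus⇔diagonal≡0 : InNucleus ≐ (λ p → diagonal p ≡ 0ᵥ)
  InNucleus⇔diagonal≡0 = (λ { {_ ∷ _ ∷ _ ∷ _ ∷ _ ∷ _ ∷ []} (refl , refl , refl) → refl })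
                       , (λ { {_ ∷ _ ∷ _ ∷ _ ∷ _ ∷ _ ∷ []} refl → refl , refl , refl })

  nucleus⇒rank2 : ∀ {p} → Normalized p → InNucleus p → Rank2 p
  nucleus⇒rank2 {_ ∷ y₁ ∷ y₂ ∷ _ ∷ y₄ ∷ _ ∷ []} p-normalized (refl , refl , refl) = det≡0 , rank≢1
    where
    det≡0 : det (0# ∷ y₁ ∷ y₂ ∷ 0# ∷ y₄ ∷ 0# ∷ []) ≡ 0#
    det≡0 = solve 3 (λ y₁ y₂ y₄ →
        con false :* (con false :* con false :+ :- (y₄ :* y₄)) :+ :- (y₁ :* (y₁ :* con false :+ :- (y₄ :* y₂)))
          :+ y₂ :* (y₁ :* y₄ :+ :- (con false :* y₂))
      := con false) refl y₁ y₂ y₄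
    principal-minor≡0⇒≡0 : ∀ y → 0# * 0# + - (y * y) ≡ 0# → y ≡ 0#
    principal-minor≡0⇒≡0 y minor≡0 = square≡0⇒≡0
      (trans (solve 1 (λ y → y :* y := con false :* con false :+ :- (y :* y)) refl y) minor≡0)
    rank≢1 : ¬ RankLE1 (0# ∷ y₁ ∷ y₂ ∷ 0# ∷ y₄ ∷ 0# ∷ [])
    rank≢1 minors≡0
      with principal-minor≡0⇒≡0 y₁ (minors≡0 0F 1F 0F 1F) | principal-minor≡0⇒≡0 y₂ (minors≡0 0F 2F 0F 2F)
         | principal-minor≡0⇒≡0 y₄ (minors≡0 1F 2F 1F 2F)
    ... | refl | refl | refl = ¬Normalized-0ᵥ p-normalized

  OffDiagonalZero : V6 → Set
  OffDiagonalZero (_ ∷ a₀₁ ∷ a₀₂ ∷ _ ∷ a₁₂ ∷ _ ∷ []) =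
    (a₀₁ ≡ 0#) × (a₀₂ ≡ 0#) × (a₁₂ ≡ 0#)

  offDiagonalZero? : Decidable OffDiagonalZero
  offDiagonalZero? (_ ∷ a₀₁ ∷ a₀₂ ∷ _ ∷ a₁₂ ∷ _ ∷ []) =
    (a₀₁ ≟ 0#) ×-dec (a₀₂ ≟ 0#) ×-dec (a₁₂ ≟ 0#)

  doubleLine⇒offDiagonalZero : ∀ {a} → IsDoubleLine a → OffDiagonalZero a
  doubleLine⇒offDiagonalZero {_ ∷ _ ∷ _ ∷ _ ∷ _ ∷ _ ∷ []}
                             (λ' , _ , _ , _ , _ , _ , (_ , a₀₁≡ , a₀₂≡ , _ , a₁₂≡ , _)) =
    trans a₀₁≡ (two*x*y≡0 λ' _) , trans a₀₂≡ (two*x*y≡0 λ' _) , trans a₁₂≡ (two*x*y≡0 λ' _)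

  offDiagonalZero⇒doubleLine : ∀ {a} → Normalized a → OffDiagonalZero a → IsDoubleLine a
  offDiagonalZero⇒doubleLine {a₀₀ ∷ _ ∷ _ ∷ a₁₁ ∷ _ ∷ a₂₂ ∷ []} a-normalized (refl , refl , refl)
    with r₀ , r₀²≡a₀₀ ← square-root a₀₀
       | r₁ , r₁²≡a₁₁ ← square-root a₁₁
       | r₂ , r₂²≡a₂₂ ← square-root a₂₂ =
      1# , r₀ , r₁ , r₂ , (λ 1≡0 → 0≢1 (sym 1≡0)) , roots≢0
    , (square r₀²≡a₀₀ , sym (two*x*y≡0 1# _) , sym (two*x*y≡0 1# _)
      , square r₁²≡a₁₁ , sym (two*x*y≡0 1# _) , square r₂²≡a₂₂)
    where
    square : ∀ {r a} → r * r ≡ a → a ≡ 1# * (r * r)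
    square r²≡a = sym (trans (*-identityˡ _) r²≡a)
    roots≢0 : ¬ ((r₀ ≡ 0#) × (r₁ ≡ 0#) × (r₂ ≡ 0#))
    roots≢0 (refl , refl , refl)
      with trans (sym r₀²≡a₀₀) (zeroˡ 0#) | trans (sym r₁²≡a₁₁) (zeroˡ 0#)
         | trans (sym r₂²≡a₂₂) (zeroˡ 0#)
    ... | refl | refl | refl = ¬Normalized-0ᵥ a-normalized

  nucleusMap : V6 → V6 → V6 → Vec Carrier 3 → Vec Carrier 3
  nucleusMap u v w x = diagonal (planePoint u v w x)

  nucleusMapᵀ : V6 → V6 → V6 → Vec Carrier 3 → Vec Carrier 3
  nucleusMapᵀ u v w y = ⟨ diagonal u , y ⟩ ∷ ⟨ diagonal v , y ⟩ ∷ ⟨ diagonal w , y ⟩ ∷ []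

  nucleusMap-adjoint : ∀ u v w x y → ⟨ nucleusMap u v w x , y ⟩ ≡ ⟨ x , nucleusMapᵀ u v w y ⟩
  nucleusMap-adjoint (u₀ ∷ _ ∷ _ ∷ u₃ ∷ _ ∷ u₅ ∷ [])
                     (v₀ ∷ _ ∷ _ ∷ v₃ ∷ _ ∷ v₅ ∷ [])
                     (w₀ ∷ _ ∷ _ ∷ w₃ ∷ _ ∷ w₅ ∷ [])
                     (x₀ ∷ x₁ ∷ x₂ ∷ []) (y₀ ∷ y₁ ∷ y₂ ∷ []) =
    solve 15 (λ u₀ u₃ u₅ v₀ v₃ v₅ w₀ w₃ w₅ x₀ x₁ x₂ y₀ y₁ y₂ →
         (x₀ :* u₀ :+ x₁ :* v₀ :+ x₂ :* w₀) :* y₀ :+ ((x₀ :* u₃ :+ x₁ :* v₃ :+ x₂ :* w₃) :* y₁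
           :+ ((x₀ :* u₅ :+ x₁ :* v₅ :+ x₂ :* w₅) :* y₂ :+ con false))
      := x₀ :* (u₀ :* y₀ :+ (u₃ :* y₁ :+ (u₅ :* y₂ :+ con false)))
           :+ (x₁ :* (v₀ :* y₀ :+ (v₃ :* y₁ :+ (v₅ :* y₂ :+ con false)))
           :+ (x₂ :* (w₀ :* y₀ :+ (w₃ :* y₁ :+ (w₅ :* y₂ :+ con false))) :+ con false)))
      refl u₀ u₃ u₅ v₀ v₃ v₅ w₀ w₃ w₅ x₀ x₁ x₂ y₀ y₁ y₂

  cone-r₂ₙ : ∀ {u v w} → LinIndep u v w →
    suc (pred q ℕ.* r₂ₙ u v w) ≡ count (λ x → nucleusMap u v w x ≟ᵥ 0ᵥ) (allVecs 3)
  cone-r₂ₙ {u} {v} {w} independent = begin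
    suc (pred q ℕ.* r₂ₙ u v w)
      ≡⟨ cong (λ m → suc (pred q ℕ.* m))
              (trans (count-filter normalized? _ (allVecs 6)) (count-≐ _ _ rank-automatic (allVecs 6))) ⟩
    suc (pred q ℕ.* count (normalized? ∩? meet?) (allVecs 6))
      ≡⟨ count-cone 6 meet? ((0# , 0# , 0# , sym (planePoint-0ᵥ u v w)) , refl , refl , refl) meet-closed ⟨
    count meet? (allVecs 6)
      ≡⟨ count-bijection (λ x → nucleusMap u v w x ≟ᵥ 0ᵥ) meet?
                         (planePoint u v w) (planePoint-injective independent)
                         (allVecs-unique 3) (allVecs-unique 6) into onto ⟨
    count (λ x → nucleusMap u v w x ≟ᵥ 0ᵥ) (allVecs 3)
      ∎
    where
    Meet : Pred V6 0ℓ
    Meet p = InPlane u v w p × InNucleus p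
    meet? : Decidable Meet
    meet? p = inPlane? u v w p ×-dec inNucleus? p
    rank-automatic : Normalized ∩ (InPlane u v w ∩ (Rank2 ∩ InNucleus)) ≐ Normalized ∩ Meet
    rank-automatic = (λ (N , P , _ , Z) → N , P , Z) , (λ (N , P , Z) → N , P , nucleus⇒rank2 N Z , Z)
    meet-closed : ScaleClosed Meet
    meet-closed {c} {p} _ ((a , b , d , p≡) , Z) =
      (c * a , c * b , c * d , trans (cong (c *ᵥ_) p≡) (planePoint-*ᵥ u v w c (a ∷ b ∷ d ∷ [])))
      , nucleus-closed p Z
      where
      nucleus-closed : ∀ p → InNucleus p → InNucleus (c *ᵥ p)
      nucleus-closed (_ ∷ _ ∷ _ ∷ _ ∷ _ ∷ _ ∷ []) (refl , refl , refl) = zeroʳ c , zeroʳ c , zeroʳ c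
    into : ∀ {x} → x ∈ allVecs 3 → nucleusMap u v w x ≡ 0ᵥ →
           planePoint u v w x ∈ allVecs 6 × Meet (planePoint u v w x)
    into {a ∷ b ∷ d ∷ []} _ M≡0 = allVecs-complete _ , (a , b , d , refl) , proj₂ InNucleus⇔diagonal≡0 M≡0
    onto : ∀ {p} → p ∈ allVecs 6 → Meet p →
           ∃ λ x → x ∈ allVecs 3 × nucleusMap u v w x ≡ 0ᵥ × planePoint u v w x ≡ p
    onto _ ((a , b , d , p≡) , Z) =
      a ∷ b ∷ d ∷ [] , allVecs-complete _
      , subst (λ p → diagonal p ≡ 0ᵥ) p≡ (proj₁ InNucleus⇔diagonal≡0 Z) , sym p≡

  cone-h₁ : ∀ u v w →
    suc (pred q ℕ.* h₁ u v w) ≡ count (λ y → nucleusMapᵀ u v w y ≟ᵥ 0ᵥ) (allVecs 3)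
  cone-h₁ u v w = begin
    suc (pred q ℕ.* h₁ u v w)
      ≡⟨ cong (λ m → suc (pred q ℕ.* m))
              (trans (count-filter normalized? _ (allVecs 6)) (count-≐ _ _ double⇔diagonal (allVecs 6))) ⟩
    suc (pred q ℕ.* count (normalized? ∩? diagonalThrough?) (allVecs 6))
      ≡⟨ count-cone 6 diagonalThrough? ((refl , refl , refl) , dot-0ᵥ u , dot-0ᵥ v , dot-0ᵥ w)
                    diagonalThrough-closed ⟨
    count diagonalThrough? (allVecs 6)
      ≡⟨ count-bijection (λ y → nucleusMapᵀ u v w y ≟ᵥ 0ᵥ) diagonalThrough?
                         diagonalForm diagonalForm-injective
                         (allVecs-unique 3) (allVecs-unique 6) into onto ⟨
    count (λ y → nucleusMapᵀ u v w y ≟ᵥ 0ᵥ) (allVecs 3)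
      ∎
    where
    DiagonalThrough : Pred V6 0ℓ
    DiagonalThrough a = OffDiagonalZero a × ContainsPlane u v w a
    diagonalThrough? : Decidable DiagonalThrough
    diagonalThrough? a = offDiagonalZero? a ×-dec containsPlane? u v w a
    double⇔diagonal : Normalized ∩ (IsDoubleLine ∩ ContainsPlane u v w) ≐ Normalized ∩ DiagonalThrough
    double⇔diagonal = (λ (N , D , C) → N , doubleLine⇒offDiagonalZero D , C)
                    , (λ (N , O , C) → N , offDiagonalZero⇒doubleLine N O , C)
    dot-0ᵥ : ∀ p → dot 0ᵥ p ≡ 0#
    dot-0ᵥ p = trans (dot-diagonalForm 0ᵥ p) (trans (⟨⟩-comm (diagonal p) 0ᵥ) (⟨0ᵥ,⟩ (diagonal p)))
    diagonalThrough-closed : ScaleClosed DiagonalThrough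
    diagonalThrough-closed {c} {a} _ (O , a·u≡0 , a·v≡0 , a·w≡0) =
      off-diagonal-closed a O , through u a·u≡0 , through v a·v≡0 , through w a·w≡0
      where
      off-diagonal-closed : ∀ a → OffDiagonalZero a → OffDiagonalZero (c *ᵥ a)
      off-diagonal-closed (_ ∷ _ ∷ _ ∷ _ ∷ _ ∷ _ ∷ []) (refl , refl , refl) = zeroʳ c , zeroʳ c , zeroʳ c
      through : ∀ p → dot a p ≡ 0# → dot (c *ᵥ a) p ≡ 0#
      through p a·p≡0 = trans (dot-*ᵥ c a p) (trans (cong (c *_) a·p≡0) (zeroʳ c))
    coordinate : ∀ {x y : Vec Carrier 3} i → x ≡ y → Vector.lookup x i ≡ Vector.lookup y i
    coordinate i = cong (λ z → Vector.lookup z i)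
    into : ∀ {y} → y ∈ allVecs 3 → nucleusMapᵀ u v w y ≡ 0ᵥ →
           diagonalForm y ∈ allVecs 6 × DiagonalThrough (diagonalForm y)
    into {y@(_ ∷ _ ∷ _ ∷ [])} _ Mᵀy≡0 = allVecs-complete _ , (refl , refl , refl)
      , trans (dot-diagonalForm y u) (coordinate 0F Mᵀy≡0)
      , trans (dot-diagonalForm y v) (coordinate 1F Mᵀy≡0)
      , trans (dot-diagonalForm y w) (coordinate 2F Mᵀy≡0)
    onto : ∀ {a} → a ∈ allVecs 6 → DiagonalThrough a →
           ∃ λ y → y ∈ allVecs 3 × nucleusMapᵀ u v w y ≡ 0ᵥ × diagonalForm y ≡ a
    onto {a@(_ ∷ _ ∷ _ ∷ _ ∷ _ ∷ _ ∷ [])} _ ((refl , refl , refl) , a·u≡0 , a·v≡0 , a·w≡0) =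
      diagonal a , allVecs-complete _
      , cong₂ _∷_ (orthogonal u a·u≡0)
                  (cong₂ _∷_ (orthogonal v a·v≡0) (cong (_∷ []) (orthogonal w a·w≡0)))
      , refl
      where
      orthogonal : ∀ p → dot a p ≡ 0# → ⟨ diagonal p , diagonal a ⟩ ≡ 0#
      orthogonal p a·p≡0 = trans (sym (dot-diagonalForm (diagonal a) p)) a·p≡0

theorem3p7 : (F : FiniteField) → 4 ≤ FiniteField.order F → 2 ∣ FiniteField.order F →
    ∀ u v w → Geometry.LinIndep F u v w →
    Geometry.r₂ₙ F u v w ≡ Geometry.h₁ F u v w
theorem3p7 F 4≤q 2∣q u v w independent =
  ℕₚ.*-cancelˡ-≡ _ _ (pred q) {{ℕ.>-nonZero (ℕₚ.pred-mono-≤ 2≤q)}} (ℕₚ.suc-injective (begin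
    suc (pred q ℕ.* r₂ₙ u v w)
      ≡⟨ cone-r₂ₙ independent ⟩
    count (λ x → nucleusMap u v w x ≟ᵥ 0ᵥ) (allVecs 3)
      ≡⟨ kernel-size-adjoint 2≤q 2 _ _ (nucleusMap-adjoint u v w) ⟩
    count (λ y → nucleusMapᵀ u v w y ≟ᵥ 0ᵥ) (allVecs 3)
      ≡⟨ cone-h₁ u v w ⟨
    suc (pred q ℕ.* h₁ u v w)
      ∎))
  where
  open Counting using (count)
  open Geometry F using (allVecs; r₂ₙ; h₁)
  open FiniteFieldProperties F using (q; even-order⇒two≡0)
  open CoordinateSpace F using (_≟ᵥ_; 0ᵥ; kernel-size-adjoint)
  open Characteristic2 F (even-order⇒two≡0 2∣q)
  open ≡-Reasoning
  2≤q : 2 ≤ q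
  2≤q = ℕₚ.≤-trans (ℕₚ.m≤m+n 2 2) 4≤q
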